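{- For every $i\ge 2$, $\operatorname{crt}(\mathcal{T}_i)\ge 2\operatorname{crt}(\mathcal{T}_{i-1})+\binom{2^{i-1}}{2}$.
   Context: A tanglegram $(L,R,\sigma)$ consists of two rooted binary trees $L,R$ with the same number of leaves and a perfect matching $\sigma$ between their leaf sets; a layout draws $L$ and $R$ as plane trees with leaves on two parallel lines and matching edges as straight segments between them, and $\operatorname{crt}(\mathcal{T})$ is the minimum number of crossing pairs of matching edges over all layouts. Let $X=\{0,1\}$ and $X^j$ the set of binary strings of length $j$. For a string $x=x_1x_2\ldots x_j$ let $x^{R}=x_jx_{j-1}\ldots x_1$ denote its reversal. For $i\in\mathbb{N}$, the tanglegram $\mathcal{T}_i=(L^{(i)},R^{(i)},\sigma_i)$ of size $2^i$ is defined as follows: $L^{(i)}$ and $R^{(i)}$ are complete rooted binary trees of height $i$; vertices of $L^{(i)}$ (resp. $R^{(i)}$) at distance $j$ from the root are labeled $u_{x}$ (resp. $w_{x}$) with $x\in X^j$, the roots being $u_\epsilon,w_\epsilon$ ($\epsilon$ the empty string), and the children of $u_x$ are $u_{x0},u_{x1}$ (similarly for $w$). The matching is $\sigma_i=\{u_{x}w_{x^{R}}: x\in X^i\}$, i.e., the leaf of $L^{(i)}$ labeled by a string is matched to the leaf of $R^{(i)}$ labeled by the reversed string. -}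

module Defs where

open import Data.Bool using (Bool; true; false; if_then_else_)
import Data.Bool.Properties as BoolP
open import Data.Nat using (ℕ; zero; suc; _+_; _<?_; _⊓_)
open import Data.List using (List; []; _∷_; [_]; map; _++_; length; filter; foldr; concatMap)
open import Data.Vec using (Vec; reverse) renaming ([] to []ᵥ; _∷_ to _∷ᵥ_)
open import Data.Vec.Properties using (≡-dec)
open import Data.Product using (_×_; _,_)
open import Relation.Nullary using (Dec; yes; no)
open import Relation.Binary.PropositionalEquality using (_≡_)

Str : ℕ → Set
Str j = Vec Bool j

-- A plane embedding (layout) of the complete rooted binary tree of height n:
-- at each internal vertex u_x we choose the left-to-right order of its two
-- children u_{x0}, u_{x1} (false = natural order x0 then x1, true = swapped).
data Embedding : ℕ → Set where
  leafE : Embedding zero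
  nodeE : {n : ℕ} → Bool → Embedding n → Embedding n → Embedding (suc n)
  -- nodeE b e0 e1 : e0 embeds the subtree of child x0, e1 that of child x1

leafOrder : {n : ℕ} → Embedding n → List (Str n)
leafOrder leafE = [ []ᵥ ]
leafOrder (nodeE b e0 e1) =
  let l0 = map (false ∷ᵥ_) (leafOrder e0)
      l1 = map (true ∷ᵥ_) (leafOrder e1)
  in if b then l1 ++ l0 else l0 ++ l1

allEmbeddings : (n : ℕ) → List (Embedding n)
allEmbeddings zero = [ leafE ]
allEmbeddings (suc n) =
  concatMap (λ b → concatMap (λ e0 → map (λ e1 → nodeE b e0 e1) (allEmbeddings n))
                             (allEmbeddings n))
            (true ∷ false ∷ [])

_≟s_ : {n : ℕ} → (x y : Str n) → Dec (x ≡ y)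
_≟s_ = ≡-dec BoolP._≟_

position : {n : ℕ} → Str n → List (Str n) → ℕ
position x [] = zero
position x (y ∷ ys) with x ≟s y
... | yes _ = zero
... | no _  = suc (position x ys)

inversions : List ℕ → ℕ
inversions [] = zero
inversions (a ∷ as) = length (filter (λ b → b <? a) as) + inversions as

-- Number of crossings of a layout of T_n: leaves on two parallel lines,
-- ordered in the same direction; the matching edges u_x w_{x^R} and
-- u_y w_{y^R} cross iff x,y appear in opposite relative order on the left
-- versus x^R, y^R on the right.
crossings : {n : ℕ} → Embedding n → Embedding n → ℕ
crossings eL eR =
  inversions (map (λ x → position (reverse x) (leafOrder eR)) (leafOrder eL))

-- Minimum of a list of naturals (only applied to nonempty lists below).
minimumℕ : List ℕ → ℕ
minimumℕ [] = zero
minimumℕ (x ∷ xs) = foldr _⊓_ x xs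

crt : ℕ → ℕ
crt n = minimumℕ (concatMap (λ eL → map (λ eR → crossings eL eR) (allEmbeddings n))
                            (allEmbeddings n))

module Submission where

-- Fix layouts of T_{n+1}.  The left root splits the leaves into the strings 0x
-- and 1x; the partner of cx is (x^R)c, a child of the leaf x^R of the right
-- tree truncated by one level.  So the right layout, truncated, orders the
-- partners of each half like a layout of T_n would, and each half of the
-- matching has at least crt(T_n) crossings.  If c is the half listed first on
-- the left and the truncated partner of y lies left of that of x, then the
-- edges of cx and c'y cross; as x ↦ position of the truncated partner is a
-- bijection onto {0, …, 2^n - 1}, this gives C(2^n, 2) further crossings.

open import Defs
open import Data.Nat using (ℕ; _+_; _*_; _∸_; _^_; _≤_)
open import Data.Nat.Combinatorics using (_C_)

open import Algebra.Bundles using (CommutativeMonoid)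
import Algebra.Properties.CommutativeSemigroup as CommutativeSemigroupProperties
open import Data.Bool using (Bool; true; false)
open import Data.Nat using (zero; suc; _<_; _≮_; _<?_; _⊓_; ⌊_/2⌋; z≤n; s≤s)
open import Data.Nat.Combinatorics using (nC1≡n; nCk+nC[k+1]≡[n+1]C[k+1])
open import Data.Nat.ListAction using (sum)
open import Data.Nat.ListAction.Properties using (sum-↭; sum-++)
open import Data.Nat.Properties
open import Data.Nat.Solver using (module +-*-Solver)
open import Data.List using (List; []; _∷_; map; _++_; length; filter; concatMap)
open import Data.List.Properties
  using ( map-++; map-cong; map-∘; length-map; length-++; filter-++; filter-accept; filter-reject
        ; foldr-preservesᵒ; foldr-preservesᵇ)
open import Data.List.Membership.Propositional using (_∈_; _∉_; lose)
open import Data.List.Membership.Propositional.Properties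
  using (∈-map⁺; ∈-map⁻; ∈-++⁺ˡ; ∈-++⁺ʳ; ∈-concatMap⁺; ∈-concatMap⁻)
open import Data.List.Relation.Binary.Permutation.Propositional
  using (_↭_; ↭-refl; ↭-sym; ↭-trans; module PermutationReasoning)
open import Data.List.Relation.Binary.Permutation.Propositional.Properties
  using (↭-length; ∈-resp-↭; filter-↭; map⁺; ++⁺; ++-comm; ++-commutativeMonoid)
open import Data.List.Relation.Unary.All as All using (All)
open import Data.List.Relation.Unary.Any as Any using (Any; here; there)
open import Data.Product using (_,_)
open import Data.Sum using (_⊎_; [_,_]; inj₁; inj₂)
open import Data.Vec using (reverse; _∷ʳ_) renaming ([] to []ᵥ; _∷_ to _∷ᵥ_)
open import Data.Vec.Properties using (reverse-∷; ∷-injectiveˡ; ∷-injectiveʳ)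
open import Function using (_∘_)
open import Function.Definitions using (Injective)
open import Relation.Binary.PropositionalEquality hiding ([_])
open import Relation.Nullary using (yes; no; contradiction)

private
  variable
    n m : ℕ

position-++ˡ : {x : Str n} {A : List (Str n)} (B : List (Str n)) →
               x ∈ A → position x (A ++ B) ≡ position x A
position-++ˡ {x = x} {y ∷ A} B x∈ with x ≟s y
... | yes _   = refl
... | no x≢y = cong suc (position-++ˡ B (Any.tail x≢y x∈))

position-++ʳ : {x : Str n} (A : List (Str n)) {B : List (Str n)} →
               x ∉ A → position x (A ++ B) ≡ length A + position x B
position-++ʳ []            x∉ = refl
position-++ʳ {x = x} (y ∷ A) x∉ with x ≟s y
... | yes x≡y = contradiction (here x≡y) x∉
... | no _    = cong suc (position-++ʳ A (x∉ ∘ there))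

position-map : {f : Str n → Str m} → Injective _≡_ _≡_ f →
               (x : Str n) (L : List (Str n)) → position (f x) (map f L) ≡ position x L
position-map         f-inj x []      = refl
position-map {f = f} f-inj x (y ∷ L) with f x ≟s f y | x ≟s y
... | yes _     | yes _   = refl
... | yes fx≡fy | no x≢y  = contradiction (f-inj fx≡fy) x≢y
... | no fx≢fy  | yes x≡y = contradiction (cong f x≡y) fx≢fy
... | no _      | no _    = cong suc (position-map f-inj x L)

∷-∉-map-∷ : {c c' : Bool} {x : Str n} (L : List (Str n)) →
            c ≢ c' → c ∷ᵥ x ∉ map (c' ∷ᵥ_) L
∷-∉-map-∷ L c≢c' x∈ with ∈-map⁻ _ x∈
... | _ , _ , eq = c≢c' (∷-injectiveˡ eq)

position-∷-++ˡ : (c : Bool) {x : Str n} {A : List (Str n)} (B : List (Str (suc n))) →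
                 x ∈ A → position (c ∷ᵥ x) (map (c ∷ᵥ_) A ++ B) ≡ position x A
position-∷-++ˡ c {x} {A} B x∈ =
  trans (position-++ˡ B (∈-map⁺ (c ∷ᵥ_) x∈)) (position-map ∷-injectiveʳ x A)

position-∷-++ʳ : {c c' : Bool} (x : Str n) (A B : List (Str n)) → c ≢ c' →
                 position (c ∷ᵥ x) (map (c' ∷ᵥ_) A ++ map (c ∷ᵥ_) B) ≡ length A + position x B
position-∷-++ʳ {c = c} {c'} x A B c≢c' = begin
  position (c ∷ᵥ x) (map (c' ∷ᵥ_) A ++ map (c ∷ᵥ_) B)
    ≡⟨ position-++ʳ (map (c' ∷ᵥ_) A) (∷-∉-map-∷ A c≢c') ⟩
  length (map (c' ∷ᵥ_) A) + position (c ∷ᵥ x) (map (c ∷ᵥ_) B)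
    ≡⟨ cong₂ _+_ (length-map (c' ∷ᵥ_) A) (position-map ∷-injectiveʳ x B) ⟩
  length A + position x B ∎
  where open ≡-Reasoning

-- Leaf positions in a layout

leafPosition : Embedding n → Str n → ℕ
leafPosition leafE []ᵥ = 0
leafPosition {suc n} (nodeE false e₀ e₁) (false ∷ᵥ x) = leafPosition e₀ x
leafPosition {suc n} (nodeE false e₀ e₁) (true  ∷ᵥ x) = 2 ^ n + leafPosition e₁ x
leafPosition {suc n} (nodeE true  e₀ e₁) (false ∷ᵥ x) = 2 ^ n + leafPosition e₀ x
leafPosition {suc n} (nodeE true  e₀ e₁) (true  ∷ᵥ x) = leafPosition e₁ x

leafOrder-nodeE-↭ : (b : Bool) (e₀ e₁ : Embedding n) →
  leafOrder (nodeE b e₀ e₁) ↭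
    map (false ∷ᵥ_) (leafOrder e₀) ++ map (true ∷ᵥ_) (leafOrder e₁)
leafOrder-nodeE-↭ false e₀ e₁ = ↭-refl
leafOrder-nodeE-↭ true  e₀ e₁ = ++-comm (map (true ∷ᵥ_) (leafOrder e₁)) _

length-leafOrder : (e : Embedding n) → length (leafOrder e) ≡ 2 ^ n
length-leafOrder leafE = refl
length-leafOrder {suc n} (nodeE b e₀ e₁) = begin
  length (leafOrder (nodeE b e₀ e₁))
    ≡⟨ ↭-length (leafOrder-nodeE-↭ b e₀ e₁) ⟩
  length (map (false ∷ᵥ_) (leafOrder e₀) ++ map (true ∷ᵥ_) (leafOrder e₁))
    ≡⟨ length-++ (map (false ∷ᵥ_) (leafOrder e₀)) ⟩
  length (map (false ∷ᵥ_) (leafOrder e₀)) + length (map (true ∷ᵥ_) (leafOrder e₁))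
    ≡⟨ cong₂ _+_ (trans (length-map _ (leafOrder e₀)) (length-leafOrder e₀))
                 (trans (length-map _ (leafOrder e₁)) (length-leafOrder e₁)) ⟩
  2 ^ n + 2 ^ n
    ≡⟨ cong (2 ^ n +_) (sym (+-identityʳ (2 ^ n))) ⟩
  2 ^ suc n ∎
  where open ≡-Reasoning

∈-leafOrder : (e : Embedding n) (x : Str n) → x ∈ leafOrder e
∈-leafOrder leafE []ᵥ = here refl
∈-leafOrder (nodeE b e₀ e₁) (false ∷ᵥ x) =
  ∈-resp-↭ (↭-sym (leafOrder-nodeE-↭ b e₀ e₁))
           (∈-++⁺ˡ (∈-map⁺ (false ∷ᵥ_) (∈-leafOrder e₀ x)))
∈-leafOrder (nodeE b e₀ e₁) (true ∷ᵥ x) =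
  ∈-resp-↭ (↭-sym (leafOrder-nodeE-↭ b e₀ e₁))
           (∈-++⁺ʳ _ (∈-map⁺ (true ∷ᵥ_) (∈-leafOrder e₁ x)))

position-leafOrder : (e : Embedding n) (x : Str n) → position x (leafOrder e) ≡ leafPosition e x
position-leafOrder leafE []ᵥ = refl
position-leafOrder (nodeE false e₀ e₁) (false ∷ᵥ x) =
  trans (position-∷-++ˡ false _ (∈-leafOrder e₀ x)) (position-leafOrder e₀ x)
position-leafOrder (nodeE false e₀ e₁) (true ∷ᵥ x) =
  trans (position-∷-++ʳ x (leafOrder e₀) _ λ ())
        (cong₂ _+_ (length-leafOrder e₀) (position-leafOrder e₁ x))
position-leafOrder (nodeE true e₀ e₁) (false ∷ᵥ x) =
  trans (position-∷-++ʳ x (leafOrder e₁) _ λ ())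
        (cong₂ _+_ (length-leafOrder e₁) (position-leafOrder e₀ x))
position-leafOrder (nodeE true e₀ e₁) (true ∷ᵥ x) =
  trans (position-∷-++ˡ true _ (∈-leafOrder e₁ x)) (position-leafOrder e₁ x)

minimumℕ-≤ : {y : ℕ} {xs : List ℕ} → y ∈ xs → minimumℕ xs ≤ y
minimumℕ-≤ {y} {x ∷ xs} y∈ = foldr-preservesᵒ ⊓-≤ x xs (starts y∈)
  where
  ⊓-≤ : ∀ a b → a ≤ y ⊎ b ≤ y → a ⊓ b ≤ y
  ⊓-≤ a b = [ ≤-trans (m⊓n≤m a b) , ≤-trans (m⊓n≤n a b) ]
  starts : y ∈ x ∷ xs → x ≤ y ⊎ Any (_≤ y) xs
  starts (here refl) = inj₁ ≤-refl
  starts (there y∈xs) = inj₂ (lose y∈xs ≤-refl)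

-- The membership witness only excludes the junk value minimumℕ [] = 0.
≤-minimumℕ : {k y : ℕ} {xs : List ℕ} → y ∈ xs → (∀ {z} → z ∈ xs → k ≤ z) → k ≤ minimumℕ xs
≤-minimumℕ {xs = x ∷ xs} _ lower =
  foldr-preservesᵇ ⊓-glb (lower (here refl)) (All.tabulate (lower ∘ there))

∈-allEmbeddings : (e : Embedding n) → e ∈ allEmbeddings n
∈-allEmbeddings leafE = here refl
∈-allEmbeddings {suc n} (nodeE b e₀ e₁) =
  ∈-concatMap⁺ withRoot (lose (∈-bools b)
    (∈-concatMap⁺ (withRootAndLeft b) (lose (∈-allEmbeddings e₀)
      (∈-map⁺ (nodeE b e₀) (∈-allEmbeddings e₁)))))
  where
  withRootAndLeft : Bool → Embedding n → List (Embedding (suc n))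
  withRootAndLeft b e₀ = map (nodeE b e₀) (allEmbeddings n)
  withRoot : Bool → List (Embedding (suc n))
  withRoot b = concatMap (withRootAndLeft b) (allEmbeddings n)
  ∈-bools : (b : Bool) → b ∈ true ∷ false ∷ []
  ∈-bools true  = here refl
  ∈-bools false = there (here refl)

crossingNumbers : ℕ → List ℕ
crossingNumbers n = concatMap (λ eL → map (crossings eL) (allEmbeddings n)) (allEmbeddings n)

∈-crossingNumbers : (eL eR : Embedding n) → crossings eL eR ∈ crossingNumbers n
∈-crossingNumbers {n} eL eR =
  ∈-concatMap⁺ (λ eL → map (crossings eL) (allEmbeddings n))
    (lose (∈-allEmbeddings eL) (∈-map⁺ (crossings eL) (∈-allEmbeddings eR)))

crt≤crossings : (eL eR : Embedding n) → crt n ≤ crossings eL eR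
crt≤crossings eL eR = minimumℕ-≤ (∈-crossingNumbers eL eR)

standardEmbedding : (n : ℕ) → Embedding n
standardEmbedding zero    = leafE
standardEmbedding (suc n) = nodeE false (standardEmbedding n) (standardEmbedding n)

≤-crt : {k : ℕ} → (∀ (eL eR : Embedding n) → k ≤ crossings eL eR) → k ≤ crt n
≤-crt {n} {k} lower =
  ≤-minimumℕ (∈-crossingNumbers (standardEmbedding n) (standardEmbedding n)) bound
  where
  row : Embedding n → List ℕ
  row eL = map (crossings eL) (allEmbeddings n)
  bound : ∀ {z} → z ∈ crossingNumbers n → k ≤ z
  bound z∈ with Any.satisfied (∈-concatMap⁻ row {allEmbeddings n} z∈)
  ... | eL , z∈row with ∈-map⁻ (crossings eL) z∈row
  ... | eR , _ , refl = lower eL eR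

-- Inversions and cross pairs of sequences of naturals

countBelow : ℕ → List ℕ → ℕ
countBelow k l = length (filter (_<? k) l)

crossPairs : List ℕ → List ℕ → ℕ
crossPairs P Q = sum (map (λ p → countBelow p Q) P)

countBelow-++ : (k : ℕ) (A B : List ℕ) → countBelow k (A ++ B) ≡ countBelow k A + countBelow k B
countBelow-++ k A B = trans (cong length (filter-++ (_<? k) A B)) (length-++ (filter (_<? k) A))

inversions-++ : (A B : List ℕ) → inversions (A ++ B) ≡ inversions A + inversions B + crossPairs A B
inversions-++ []      B = sym (+-identityʳ (inversions B))
inversions-++ (a ∷ A) B = begin
  countBelow a (A ++ B) + inversions (A ++ B)
    ≡⟨ cong₂ _+_ (countBelow-++ a A B) (inversions-++ A B) ⟩
  (countBelow a A + countBelow a B) + (inversions A + inversions B + crossPairs A B)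
    ≡⟨ regroup (countBelow a A) (countBelow a B) (inversions A) (inversions B) (crossPairs A B) ⟩
  (countBelow a A + inversions A) + inversions B + (countBelow a B + crossPairs A B) ∎
  where
  open ≡-Reasoning
  open +-*-Solver
  regroup : ∀ x y u v w → (x + y) + (u + v + w) ≡ (x + u) + v + (y + w)
  regroup = solve 5 (λ x y u v w → (x :+ y) :+ (u :+ v :+ w) := (x :+ u) :+ v :+ (y :+ w)) refl

countBelow-∷-< : {y k : ℕ} (l : List ℕ) → y < k → countBelow k (y ∷ l) ≡ suc (countBelow k l)
countBelow-∷-< {k = k} l y<k = cong length (filter-accept (_<? k) y<k)

countBelow-∷-≮ : {y k : ℕ} (l : List ℕ) → y ≮ k → countBelow k (y ∷ l) ≡ countBelow k l
countBelow-∷-≮ {k = k} l y≮k = cong length (filter-reject (_<? k) y≮k)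

countBelow-map-mono : {A : Set} {h g : A → ℕ} {k k' : ℕ} → (∀ x → h x < k → g x < k') →
                      (l : List A) → countBelow k (map h l) ≤ countBelow k' (map g l)
countBelow-map-mono                      below []      = z≤n
countBelow-map-mono {h = h} {g} {k} {k'} below (x ∷ l) with h x <? k | g x <? k'
... | yes hx< | yes gx<
  rewrite countBelow-∷-< (map h l) hx< | countBelow-∷-< (map g l) gx<
  = s≤s (countBelow-map-mono below l)
... | yes hx< | no gx≮ = contradiction (below x hx<) gx≮
... | no hx≮  | yes gx<
  rewrite countBelow-∷-≮ (map h l) hx≮ | countBelow-∷-< (map g l) gx<
  = m≤n⇒m≤1+n (countBelow-map-mono below l)
... | no hx≮  | no gx≮
  rewrite countBelow-∷-≮ (map h l) hx≮ | countBelow-∷-≮ (map g l) gx≮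
  = countBelow-map-mono below l

inversions-map-mono : {A : Set} {h g : A → ℕ} → (∀ x y → h y < h x → g y < g x) →
                      (l : List A) → inversions (map h l) ≤ inversions (map g l)
inversions-map-mono reflects []      = z≤n
inversions-map-mono reflects (x ∷ l) =
  +-mono-≤ (countBelow-map-mono (reflects x) l) (inversions-map-mono reflects l)

crossPairs-map-mono : {A B : Set} {h g : A → ℕ} {h' g' : B → ℕ} →
                      (∀ a b → h' b < h a → g' b < g a) → (As : List A) (Bs : List B) →
                      crossPairs (map h As) (map h' Bs) ≤ crossPairs (map g As) (map g' Bs)
crossPairs-map-mono reflects []       Bs = z≤n
crossPairs-map-mono reflects (a ∷ As) Bs =
  +-mono-≤ (countBelow-map-mono (reflects a) Bs) (crossPairs-map-mono reflects As Bs)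

crossPairs-↭ : {P P' Q Q' : List ℕ} → P ↭ P' → Q ↭ Q' → crossPairs P Q ≡ crossPairs P' Q'
crossPairs-↭ {P} {P'} {Q} {Q'} P↭P' Q↭Q' = begin
  sum (map (λ p → countBelow p Q) P)
    ≡⟨ cong sum (map-cong (λ p → ↭-length (filter-↭ (_<? p) Q↭Q')) P) ⟩
  sum (map (λ p → countBelow p Q') P)
    ≡⟨ sum-↭ (map⁺ (λ p → countBelow p Q') P↭P') ⟩
  sum (map (λ p → countBelow p Q') P') ∎
  where open ≡-Reasoning

range : ℕ → ℕ → List ℕ
range s zero    = []
range s (suc m) = s ∷ range (suc s) m

range-+ : (s a b : ℕ) → range s (a + b) ≡ range s a ++ range (s + a) b
range-+ s zero    b = cong (λ t → range t b) (sym (+-identityʳ s))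
range-+ s (suc a) b =
  cong (s ∷_) (trans (range-+ (suc s) a b) (cong (λ t → range (suc s) a ++ range t b) (sym (+-suc s a))))

countBelow-range : (k s m : ℕ) → countBelow k (range s m) ≡ (k ∸ s) ⊓ m
countBelow-range k s zero = sym (⊓-zeroʳ (k ∸ s))
countBelow-range k s (suc m) with s <? k
... | yes s<k = begin
  countBelow k (s ∷ range (suc s) m) ≡⟨ countBelow-∷-< (range (suc s) m) s<k ⟩
  suc (countBelow k (range (suc s) m)) ≡⟨ cong suc (countBelow-range k (suc s) m) ⟩
  suc ((k ∸ suc s) ⊓ m)                ≡⟨ cong (_⊓ suc m) (sym (+-∸-assoc 1 s<k)) ⟩
  (k ∸ s) ⊓ suc m ∎
  where open ≡-Reasoning
... | no s≮k = begin
  countBelow k (s ∷ range (suc s) m) ≡⟨ countBelow-∷-≮ (range (suc s) m) s≮k ⟩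
  countBelow k (range (suc s) m)     ≡⟨ countBelow-range k (suc s) m ⟩
  (k ∸ suc s) ⊓ m                    ≡⟨ cong (_⊓ m) (m≤n⇒m∸n≡0 (m≤n⇒m≤1+n k≤s)) ⟩
  0                                  ≡⟨ cong (_⊓ suc m) (m≤n⇒m∸n≡0 k≤s) ⟨
  (k ∸ s) ⊓ suc m ∎
  where
  open ≡-Reasoning
  k≤s : k ≤ s
  k≤s = ≮⇒≥ s≮k

crossPairs-range : {N : ℕ} (s m : ℕ) → s + m ≤ N →
                   crossPairs (range s m) (range 0 N) ≡ sum (range s m)
crossPairs-range     s zero    _      = refl
crossPairs-range {N} s (suc m) s+m<N = cong₂ _+_
  (trans (countBelow-range s 0 N) (m≤n⇒m⊓n≡m (≤-trans (m≤m+n s (suc m)) s+m<N)))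
  (crossPairs-range (suc s) m (subst (_≤ N) (+-suc s m) s+m<N))

sum-range : (m : ℕ) → sum (range 0 m) ≡ m C 2
sum-range zero    = refl
sum-range (suc m) = begin
  sum (range 0 (suc m))     ≡⟨ cong (sum ∘ range 0) (+-comm 1 m) ⟩
  sum (range 0 (m + 1))     ≡⟨ cong sum (range-+ 0 m 1) ⟩
  sum (range 0 m ++ m ∷ []) ≡⟨ sum-++ (range 0 m) (m ∷ []) ⟩
  sum (range 0 m) + (m + 0) ≡⟨ cong₂ _+_ (sum-range m) (trans (+-identityʳ m) (sym (nC1≡n m))) ⟩
  m C 2 + m C 1             ≡⟨ +-comm (m C 2) (m C 1) ⟩
  m C 1 + m C 2             ≡⟨ nCk+nC[k+1]≡[n+1]C[k+1] m 1 ⟩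
  suc m C 2 ∎
  where open ≡-Reasoning

crossPairs-↭-range : {N : ℕ} {P Q : List ℕ} →
                     P ↭ range 0 N → Q ↭ range 0 N → crossPairs P Q ≡ N C 2
crossPairs-↭-range {N} P↭ Q↭ =
  trans (crossPairs-↭ P↭ Q↭) (trans (crossPairs-range 0 N ≤-refl) (sum-range N))

range-halves : (s n : ℕ) → range s (2 ^ n) ++ range (s + 2 ^ n) (2 ^ n) ≡ range s (2 ^ suc n)
range-halves s n =
  trans (sym (range-+ s (2 ^ n) (2 ^ n))) (cong (range s ∘ (2 ^ n +_)) (sym (+-identityʳ (2 ^ n))))

map-leafPosition-leafOrder : (e : Embedding n) (s : ℕ) →
                             map (λ x → s + leafPosition e x) (leafOrder e) ≡ range s (2 ^ n)
map-leafPosition-leafOrder leafE s = cong (_∷ []) (+-identityʳ s)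
map-leafPosition-leafOrder {suc n} (nodeE false e₀ e₁) s =
  trans (map-++ _ (map (false ∷ᵥ_) (leafOrder e₀)) _)
        (trans (cong₂ _++_ (trans (sym (map-∘ (leafOrder e₀))) (map-leafPosition-leafOrder e₀ s))
                           (trans (sym (map-∘ (leafOrder e₁))) (shifted e₁)))
               (range-halves s n))
  where
  shifted : (e : Embedding n) →
            map (λ x → s + (2 ^ n + leafPosition e x)) (leafOrder e) ≡ range (s + 2 ^ n) (2 ^ n)
  shifted e = trans (map-cong (λ x → sym (+-assoc s (2 ^ n) (leafPosition e x))) (leafOrder e))
                    (map-leafPosition-leafOrder e (s + 2 ^ n))
map-leafPosition-leafOrder {suc n} (nodeE true e₀ e₁) s =
  trans (map-++ _ (map (true ∷ᵥ_) (leafOrder e₁)) _)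
        (trans (cong₂ _++_ (trans (sym (map-∘ (leafOrder e₁))) (map-leafPosition-leafOrder e₁ s))
                           (trans (sym (map-∘ (leafOrder e₀))) (shifted e₀)))
               (range-halves s n))
  where
  shifted : (e : Embedding n) →
            map (λ x → s + (2 ^ n + leafPosition e x)) (leafOrder e) ≡ range (s + 2 ^ n) (2 ^ n)
  shifted e = trans (map-cong (λ x → sym (+-assoc s (2 ^ n) (leafPosition e x))) (leafOrder e))
                    (map-leafPosition-leafOrder e (s + 2 ^ n))

-- Layouts as permutations of the strings

leafOrder-↭ : (e e' : Embedding n) → leafOrder e ↭ leafOrder e'
leafOrder-↭ leafE leafE = ↭-refl
leafOrder-↭ (nodeE b e₀ e₁) (nodeE b' e₀' e₁') =
  ↭-trans (leafOrder-nodeE-↭ b e₀ e₁)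
    (↭-trans (++⁺ (map⁺ (false ∷ᵥ_) (leafOrder-↭ e₀ e₀'))
                  (map⁺ (true ∷ᵥ_) (leafOrder-↭ e₁ e₁')))
             (↭-sym (leafOrder-nodeE-↭ b' e₀' e₁')))

standardOrder : (n : ℕ) → List (Str n)
standardOrder n = leafOrder (standardEmbedding n)

map-∷ʳ-map-∷ : (c d : Bool) (L : List (Str n)) →
               map (_∷ʳ c) (map (d ∷ᵥ_) L) ≡ map (d ∷ᵥ_) (map (_∷ʳ c) L)
map-∷ʳ-map-∷ c d L = trans (sym (map-∘ L)) (map-∘ L)

standardOrder-∷ʳ-↭ : (n : ℕ) →
  map (_∷ʳ false) (standardOrder n) ++ map (_∷ʳ true) (standardOrder n) ↭ standardOrder (suc n)
standardOrder-∷ʳ-↭ zero    = ↭-refl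
standardOrder-∷ʳ-↭ (suc n) = begin
  map (_∷ʳ false) (pre false S ++ pre true S) ++ map (_∷ʳ true) (pre false S ++ pre true S)
    ≡⟨ cong₂ _++_ (swapMaps false) (swapMaps true) ⟩
  (pre false S₀ ++ pre true S₀) ++ (pre false S₁ ++ pre true S₁)
    ↭⟨ interchange (pre false S₀) (pre true S₀) (pre false S₁) (pre true S₁) ⟩
  (pre false S₀ ++ pre false S₁) ++ (pre true S₀ ++ pre true S₁)
    ≡⟨ cong₂ _++_ (map-++ (false ∷ᵥ_) S₀ S₁) (map-++ (true ∷ᵥ_) S₀ S₁) ⟨
  pre false (S₀ ++ S₁) ++ pre true (S₀ ++ S₁)
    ↭⟨ ++⁺ (map⁺ (false ∷ᵥ_) IH) (map⁺ (true ∷ᵥ_) IH) ⟩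
  standardOrder (suc (suc n)) ∎
  where
  open PermutationReasoning
  open CommutativeSemigroupProperties
    (CommutativeMonoid.commutativeSemigroup (++-commutativeMonoid {A = Str (suc (suc n))}))
    using (interchange)
  IH : map (_∷ʳ false) (standardOrder n) ++ map (_∷ʳ true) (standardOrder n) ↭ standardOrder (suc n)
  IH = standardOrder-∷ʳ-↭ n
  pre : {k : ℕ} → Bool → List (Str k) → List (Str (suc k))
  pre c = map (c ∷ᵥ_)
  S : List (Str n)
  S  = standardOrder n
  S₀ S₁ : List (Str (suc n))
  S₀ = map (_∷ʳ false) S
  S₁ = map (_∷ʳ true) S
  swapMaps : (c : Bool) → map (_∷ʳ c) (pre false S ++ pre true S) ≡
                           pre false (map (_∷ʳ c) S) ++ pre true (map (_∷ʳ c) S)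
  swapMaps c = trans (map-++ (_∷ʳ c) (pre false S) _)
                     (cong₂ _++_ (map-∷ʳ-map-∷ c false S) (map-∷ʳ-map-∷ c true S))

map-reverse-standardOrder-↭ : (n : ℕ) → map reverse (standardOrder n) ↭ standardOrder n
map-reverse-standardOrder-↭ zero    = ↭-refl
map-reverse-standardOrder-↭ (suc n) = begin
  map reverse (map (false ∷ᵥ_) S ++ map (true ∷ᵥ_) S)
    ≡⟨ trans (map-++ reverse (map (false ∷ᵥ_) S) _)
             (cong₂ _++_ (reverse-map-∷ false) (reverse-map-∷ true)) ⟩
  map (_∷ʳ false) (map reverse S) ++ map (_∷ʳ true) (map reverse S)
    ↭⟨ ++⁺ (map⁺ (_∷ʳ false) IH) (map⁺ (_∷ʳ true) IH) ⟩
  map (_∷ʳ false) S ++ map (_∷ʳ true) S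
    ↭⟨ standardOrder-∷ʳ-↭ n ⟩
  standardOrder (suc n) ∎
  where
  open PermutationReasoning
  IH : map reverse (standardOrder n) ↭ standardOrder n
  IH = map-reverse-standardOrder-↭ n
  S : List (Str n)
  S = standardOrder n
  reverse-map-∷ : (c : Bool) → map reverse (map (c ∷ᵥ_) S) ≡ map (_∷ʳ c) (map reverse S)
  reverse-map-∷ c = trans (sym (map-∘ S)) (trans (map-cong (reverse-∷ c) S) (map-∘ S))

map-reverse-leafOrder-↭ : (e e' : Embedding n) → map reverse (leafOrder e) ↭ leafOrder e'
map-reverse-leafOrder-↭ {n} e e' =
  ↭-trans (map⁺ reverse (leafOrder-↭ e (standardEmbedding n)))
    (↭-trans (map-reverse-standardOrder-↭ n) (leafOrder-↭ (standardEmbedding n) e'))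

-- Forgetting the bottom level of a layout

truncate : Embedding (suc n) → Embedding n
truncate {zero}  _               = leafE
truncate {suc n} (nodeE b e₀ e₁) = nodeE b (truncate e₀) (truncate e₁)

⌊2*m+n/2⌋≡m+⌊n/2⌋ : (m n : ℕ) → ⌊ 2 * m + n /2⌋ ≡ m + ⌊ n /2⌋
⌊2*m+n/2⌋≡m+⌊n/2⌋ zero    n = refl
⌊2*m+n/2⌋≡m+⌊n/2⌋ (suc m) n =
  trans (cong (⌊_/2⌋ ∘ (_+ n)) (*-suc 2 m)) (cong suc (⌊2*m+n/2⌋≡m+⌊n/2⌋ m n))

⌊leafPosition/2⌋≡truncate : (e : Embedding (suc n)) (z : Str n) (c : Bool) →
                   ⌊ leafPosition e (z ∷ʳ c) /2⌋ ≡ leafPosition (truncate e) z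
⌊leafPosition/2⌋≡truncate {zero}  (nodeE false leafE leafE) []ᵥ false = refl
⌊leafPosition/2⌋≡truncate {zero}  (nodeE false leafE leafE) []ᵥ true  = refl
⌊leafPosition/2⌋≡truncate {zero}  (nodeE true  leafE leafE) []ᵥ false = refl
⌊leafPosition/2⌋≡truncate {zero}  (nodeE true  leafE leafE) []ᵥ true  = refl
⌊leafPosition/2⌋≡truncate {suc n} (nodeE false e₀ e₁) (false ∷ᵥ z) c = ⌊leafPosition/2⌋≡truncate e₀ z c
⌊leafPosition/2⌋≡truncate {suc n} (nodeE true  e₀ e₁) (true  ∷ᵥ z) c = ⌊leafPosition/2⌋≡truncate e₁ z c
⌊leafPosition/2⌋≡truncate {suc n} (nodeE false e₀ e₁) (true  ∷ᵥ z) c =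
  trans (⌊2*m+n/2⌋≡m+⌊n/2⌋ (2 ^ n) _) (cong (2 ^ n +_) (⌊leafPosition/2⌋≡truncate e₁ z c))
⌊leafPosition/2⌋≡truncate {suc n} (nodeE true  e₀ e₁) (false ∷ᵥ z) c =
  trans (⌊2*m+n/2⌋≡m+⌊n/2⌋ (2 ^ n) _) (cong (2 ^ n +_) (⌊leafPosition/2⌋≡truncate e₀ z c))

partnerPosition : Embedding n → Str n → ℕ
partnerPosition eR x = leafPosition eR (reverse x)

crossings≡inversions : (eL eR : Embedding n) →
                       crossings eL eR ≡ inversions (map (partnerPosition eR) (leafOrder eL))
crossings≡inversions eL eR =
  cong inversions (map-cong (λ x → position-leafOrder eR (reverse x)) (leafOrder eL))

-- Prefixing a left leaf by c appends c to its partner, so the partner lies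
-- directly below the partner of the unprefixed leaf in the truncated layout.
partnerPosition-truncate-reflects-< : (e : Embedding (suc n)) (c c' : Bool) (x x' : Str n) →
  partnerPosition (truncate e) x < partnerPosition (truncate e) x' →
  partnerPosition e (c ∷ᵥ x) < partnerPosition e (c' ∷ᵥ x')
partnerPosition-truncate-reflects-< e c c' x x' p<p' =
  ≰⇒> λ q'≤q → <⇒≱ p<p' (subst₂ _≤_ (halve c' x') (halve c x) (⌊n/2⌋-mono q'≤q))
  where
  halve : ∀ c x → ⌊ partnerPosition e (c ∷ᵥ x) /2⌋ ≡ partnerPosition (truncate e) x
  halve c x = trans (cong (⌊_/2⌋ ∘ leafPosition e) (reverse-∷ c x))
                    (⌊leafPosition/2⌋≡truncate e (reverse x) c)

map-partnerPosition-↭-range : (eR eL : Embedding n) →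
                              map (partnerPosition eR) (leafOrder eL) ↭ range 0 (2 ^ n)
map-partnerPosition-↭-range {n} eR eL = begin
  map (leafPosition eR ∘ reverse) (leafOrder eL)
    ≡⟨ map-∘ (leafOrder eL) ⟩
  map (leafPosition eR) (map reverse (leafOrder eL))
    ↭⟨ map⁺ (leafPosition eR) (map-reverse-leafOrder-↭ eL eR) ⟩
  map (leafPosition eR) (leafOrder eR)
    ≡⟨ map-leafPosition-leafOrder eR 0 ⟩
  range 0 (2 ^ n) ∎
  where open PermutationReasoning

-- The recursive lower bound

inversions-halves-≥ : (eR : Embedding (suc n)) (c c' : Bool) (e e' : Embedding n) →
  2 * crt n + (2 ^ n) C 2 ≤
    inversions (map (partnerPosition eR) (map (c ∷ᵥ_) (leafOrder e) ++ map (c' ∷ᵥ_) (leafOrder e')))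
inversions-halves-≥ {n} eR c c' e e' = begin
  2 * crt n + (2 ^ n) C 2
    ≤⟨ +-mono-≤ (double-≤ (within c e) (within c' e')) between ⟩
  inversions (map ρ₀ L) + inversions (map ρ₁ L') + crossPairs (map ρ₀ L) (map ρ₁ L')
    ≡⟨ inversions-++ (map ρ₀ L) (map ρ₁ L') ⟨
  inversions (map ρ₀ L ++ map ρ₁ L')
    ≡⟨ cong inversions (trans (cong₂ _++_ (map-∘ L) (map-∘ L')) (sym (map-++ ρ (map (c ∷ᵥ_) L) _))) ⟩
  inversions (map ρ (map (c ∷ᵥ_) L ++ map (c' ∷ᵥ_) L')) ∎
  where
  open ≤-Reasoning
  L L' : List (Str n)
  L  = leafOrder e
  L' = leafOrder e'
  eT : Embedding n
  eT = truncate eR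
  ρ : Str (suc n) → ℕ
  ρ = partnerPosition eR
  ρ₀ ρ₁ : Str n → ℕ
  ρ₀ = ρ ∘ (c ∷ᵥ_)
  ρ₁ = ρ ∘ (c' ∷ᵥ_)
  double-≤ : {a x y : ℕ} → a ≤ x → a ≤ y → 2 * a ≤ x + y
  double-≤ {a} a≤x a≤y = +-mono-≤ a≤x (subst (_≤ _) (sym (+-identityʳ a)) a≤y)
  within : (d : Bool) (f : Embedding n) → crt n ≤ inversions (map (ρ ∘ (d ∷ᵥ_)) (leafOrder f))
  within d f = begin
    crt n                                                ≤⟨ crt≤crossings f eT ⟩
    crossings f eT                                       ≡⟨ crossings≡inversions f eT ⟩
    inversions (map (partnerPosition eT) (leafOrder f))
      ≤⟨ inversions-map-mono (λ x y → partnerPosition-truncate-reflects-< eR d d y x) (leafOrder f) ⟩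
    inversions (map (ρ ∘ (d ∷ᵥ_)) (leafOrder f)) ∎
  between : (2 ^ n) C 2 ≤ crossPairs (map ρ₀ L) (map ρ₁ L')
  between = begin
    (2 ^ n) C 2
      ≡⟨ crossPairs-↭-range (map-partnerPosition-↭-range eT e) (map-partnerPosition-↭-range eT e') ⟨
    crossPairs (map (partnerPosition eT) L) (map (partnerPosition eT) L')
      ≤⟨ crossPairs-map-mono (λ a b → partnerPosition-truncate-reflects-< eR c' c b a) L L' ⟩
    crossPairs (map ρ₀ L) (map ρ₁ L') ∎

crossings-suc-≥ : (eL eR : Embedding (suc n)) → 2 * crt n + (2 ^ n) C 2 ≤ crossings eL eR
crossings-suc-≥ eL@(nodeE false e₀ e₁) eR =
  subst (_ ≤_) (sym (crossings≡inversions eL eR)) (inversions-halves-≥ eR false true e₀ e₁)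
crossings-suc-≥ eL@(nodeE true  e₀ e₁) eR =
  subst (_ ≤_) (sym (crossings≡inversions eL eR)) (inversions-halves-≥ eR true false e₁ e₀)

mainTheorem2 : (i : ℕ) → 2 ≤ i →
    2 * crt (i ∸ 1) + (2 ^ (i ∸ 1)) C 2 ≤ crt i
mainTheorem2 (suc n) _ = ≤-crt (crossings-suc-≥ {n})
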